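{- Let $G$ be a finite 3-regular graph, let $v$ be a vertex of $G$, and let $w_1,w_2$ be distinct neighbors of $v$. Let $f$ be a partial 2-tone 8-coloring of $G$ that leaves $v$, $w_1$ and $w_2$ uncolored, and let $f_1,f_2,f_3$ be three distinct extensions of $f$ to $w_1$. Suppose some second-neighbor $x$ of $v$ yields an obstruction of $v$ under none of $f_1,f_2,f_3$. Then for some $i\in\{1,2,3\}$, $f_i$ can be extended to $v$ in at least three different ways.
   Context: $d(u,v)$ denotes graph distance; $u,v$ are second-neighbors if $d(u,v)=2$. A partial 2-tone $k$-coloring of $G$ is a function $f:S\to\binom{[k]}{2}$ with $S\subseteq V(G)$ such that $|f(u)\cap f(v)|<d(u,v)$ for all distinct $u,v\in S$; vertices outside $S$ are uncolored. An extension of $f$ to an uncolored vertex $v$ is a partial 2-tone $k$-coloring defined on $S\cup\{v\}$ agreeing with $f$ on $S$. For a partial coloring $g$ and uncolored vertex $v$: a valid label for $v$ is a label by which $g$ can be extended to $v$; a free color at $v$ is a color in $[8]$ not appearing in the label of any neighbor of $v$; a candidate label for $v$ is a 2-element set of free colors; an obstruction of $v$ is a candidate label that is not valid because it equals the label of some second-neighbor of $v$. A second-neighbor $x$ of $v$ yields an obstruction of $v$ under $g$ if $x$ is colored by $g$ and $g(x)$ is a candidate label for $v$. -}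

module Defs where

open import Level using (0ℓ)
open import Data.Nat using (ℕ; zero; suc; _≤_)
open import Data.Fin using (Fin)
open import Data.Fin.Subset using (Subset; _∈_; _∉_; _∩_; ∣_∣)
open import Data.Vec using (Vec; _∷_; [])
open import Data.Maybe using (Maybe; just; nothing; Is-just)
open import Data.Sum using (_⊎_)
open import Data.Product using (Σ; _×_; ∃; ∃-syntax)
open import Relation.Nullary using (¬_)
open import Relation.Binary.PropositionalEquality using (_≡_; _≢_)

record Graph (n : ℕ) : Set₁ where
  field
    Adj     : Fin n → Fin n → Set
    sym     : ∀ {u v} → Adj u v → Adj v u
    irrefl  : ∀ {u} → ¬ Adj u u
open Graph public

Cubic : ∀ {n} → Graph n → Set
Cubic {n} G = ∀ v → Σ (Fin n) λ a → Σ (Fin n) λ b → Σ (Fin n) λ c →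
  a ≢ b × a ≢ c × b ≢ c × (∀ u → (Adj G v u → (u ≡ a ⊎ u ≡ b ⊎ u ≡ c)) × ((u ≡ a ⊎ u ≡ b ⊎ u ≡ c) → Adj G v u))

data Walk {n} (G : Graph n) : Fin n → Fin n → ℕ → Set where
  here : ∀ {u} → Walk G u u zero
  step : ∀ {u w v k} → Adj G u w → Walk G w v k → Walk G u v (suc k)

-- m < d(u,v), where d is the graph distance (∞ if no walk exists):
-- no walk of length ≤ m joins u and v.
_<dist[_]_,_ : ∀ {n} → ℕ → Graph n → Fin n → Fin n → Set
m <dist[ G ] u , v = ∀ j → j ≤ m → ¬ Walk G u v j

SecondNbr : ∀ {n} → Graph n → Fin n → Fin n → Set
SecondNbr G u v = Walk G u v 2 × (1 <dist[ G ] u , v)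

PColoring : ℕ → Set
PColoring n = Fin n → Maybe (Subset 8)

Is2Tone8 : ∀ {n} → Graph n → PColoring n → Set
Is2Tone8 G f =
  (∀ v s → f v ≡ just s → ∣ s ∣ ≡ 2) ×
  (∀ u v s t → u ≢ v → f u ≡ just s → f v ≡ just t → ∣ s ∩ t ∣ <dist[ G ] u , v)

Extension : ∀ {n} → Graph n → PColoring n → PColoring n → Fin n → Set
Extension G f g v =
  Is2Tone8 G g × f v ≡ nothing × Is-just (g v) × (∀ u → u ≢ v → g u ≡ f u)

Differ : ∀ {n} → PColoring n → PColoring n → Set
Differ g h = ¬ (∀ u → g u ≡ h u)

Free : ∀ {n} → Graph n → PColoring n → Fin n → Fin 8 → Set
Free G g v c = ∀ u t → Adj G v u → g u ≡ just t → c ∉ t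

Candidate : ∀ {n} → Graph n → PColoring n → Fin n → Subset 8 → Set
Candidate G g v s = ∣ s ∣ ≡ 2 × (∀ c → c ∈ s → Free G g v c)

YieldsObstruction : ∀ {n} → Graph n → PColoring n → Fin n → Fin n → Set
YieldsObstruction G g x v =
  SecondNbr G x v × Σ (Subset 8) λ s → g x ≡ just s × Candidate G g v s

module Submission where

-- Under fᵢ a free pair (a 2-set avoiding the colours Lᵢ ∪ C of the
-- neighbours, C the label of w₃) is a valid label for v unless a second-neighbour carries it.
-- v has at most six second-neighbours and x obstructs no fᵢ, so at most five labels Y forbid.
--
-- The proof counts 2-subsets of [8]: fᵢ has C(8 − |Lᵢ ∪ C|, 2) free pairs.  If |Lᵢ ∪ C| ≤ 3
-- that is ≥ 10, so ≥ 5 are valid.  Otherwise every Lᵢ ∪ C has four colours, and an fᵢ with at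
-- most two valid labels has at least four obstructed ones; yet the three obstruction counts add
-- up to at most 11: if |L₁ ∪ L₂ ∪ L₃| ≥ 4 at most one pair avoids all colours, and if it is 3,
-- any two Lᵢ cover it, so a pair free for two fᵢ is one of the ≤ 3 pairs free for all.

open import Defs hiding (sym)
open import Data.Nat using (ℕ; zero; suc; _+_; _≤_; _≤′_; ≤′-refl; ≤′-step; z≤n; s≤s; _≡ᵇ_)
open import Data.Nat.Properties
  using (≤-refl; ≤-trans; ≤-reflexive; ≤-pred; ≤-antisym; ≤⇒≤′; <-irrefl; _≤?_; ≰⇒>; ≤⇒≤ᵇ; ≡ᵇ⇒≡; ≡⇒≡ᵇ;
         +-mono-≤; +-monoˡ-≤; +-monoʳ-≤; +-cancelʳ-≤; +-cancelˡ-≤; +-suc; +-identityʳ; m≤m+n; m≤n+m;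
         m+n≤o⇒m≤o∸n; m≤n+o⇒m∸n≤o; n≤0⇒n≡0; suc-injective; +-commutativeSemigroup; module ≤-Reasoning)
open import Algebra.Properties.CommutativeSemigroup +-commutativeSemigroup using (interchange)
open import Data.Nat.Combinatorics using (nCk+nC[k+1]≡[n+1]C[k+1]) renaming (_C_ to _choose_)
open import Data.Bool using (Bool; true; false; T; _∧_; _∨_; not; if_then_else_)
import Data.Bool.Properties as Bool
open import Data.Vec using ([]; _∷_)
open import Data.Vec.Base using (here; there)
open import Data.Vec.Properties using (≡-dec)
open import Data.Fin using (Fin; _≟_)
open import Data.Fin.Subset using (Subset; inside; outside; _∈_; _∉_; _⊆_; _∪_; _∩_; ∣_∣; ∁) renaming (⊥ to ∅)
open import Data.Fin.Subset.Properties
  using (∣∁p∣≡n∸∣p∣; drop-∷-⊆; p⊆q⇒∣p∣≤∣q∣; p∩q⊆p; ∣p∩q∣≤∣p∣; ∩-comm; p⊆p∪q; q⊆p∪q; x∈p∪q⁻; x∈p∩q⁻;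
         ∩-distribʳ-∪; Empty-unique; ∣⊥∣≡0)
open import Data.List using (List; []; _∷_; _++_; length; map)
open import Data.List.Properties using (length-map; length-removeAt′)
open import Data.List.Membership.Propositional using () renaming (_∈_ to _∈ˡ_)
import Data.List.Membership.DecPropositional as DecMembership
open import Data.List.Membership.Propositional.Properties using (∈-++⁺ˡ; ∈-++⁺ʳ; ∈-map⁺)
open import Data.List.Relation.Unary.Any using (here; there; _─_)
open import Data.List.Relation.Unary.Any.Properties using (lookup-result)
import Data.List.Relation.Unary.All as All
open import Data.List.Relation.Unary.All.Properties using (─⁻)
open import Data.Maybe using (Maybe; just; nothing; Is-just; fromMaybe)
open import Data.Maybe.Properties using (just-injective)
import Data.Maybe.Relation.Unary.Any as MaybeAny
open import Data.Product using (Σ; ∃; _×_; _,_; proj₁; proj₂)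
import Data.Product as Product
open import Data.Sum using (_⊎_; inj₁; inj₂; [_,_])
open import Data.Empty using (⊥; ⊥-elim)
open import Data.Unit using (tt)
open import Function using (id; _∘_)
open import Function.Bundles using (Equivalence)
open import Relation.Nullary using (¬_; does; yes; no)
open import Relation.Nullary.Decidable using (dec-true)
open import Relation.Binary.Definitions using (DecidableEquality)
open import Relation.Binary.PropositionalEquality
  using (_≡_; _≢_; refl; cong; cong₂; sym; trans; subst; subst₂; module ≡-Reasoning)

-- 1. Counting subsets of Fin n.  A predicate on subsets is a boolean function; its count is
-- the sum of its indicator over all 2ⁿ subsets.

ind : Bool → ℕ
ind b = if b then 1 else 0

ind-mono : ∀ a b → (T a → T b) → ind a ≤ ind b
ind-mono false b _ = z≤n
ind-mono true true _ = ≤-refl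
ind-mono true false a⇒b = ⊥-elim (a⇒b tt)

sumSubsets : ∀ {n} → (Subset n → ℕ) → ℕ
sumSubsets {zero} g = g []
sumSubsets {suc n} g = sumSubsets (λ s → g (inside ∷ s)) + sumSubsets (λ s → g (outside ∷ s))

sumSubsets-cong : ∀ {n} {g h : Subset n → ℕ} → (∀ s → g s ≡ h s) → sumSubsets g ≡ sumSubsets h
sumSubsets-cong {zero} g≡h = g≡h []
sumSubsets-cong {suc n} g≡h =
  cong₂ _+_ (sumSubsets-cong (λ s → g≡h (inside ∷ s))) (sumSubsets-cong (λ s → g≡h (outside ∷ s)))

sumSubsets-mono : ∀ {n} {g h : Subset n → ℕ} → (∀ s → g s ≤ h s) → sumSubsets g ≤ sumSubsets h
sumSubsets-mono {zero} g≤h = g≤h []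
sumSubsets-mono {suc n} g≤h =
  +-mono-≤ (sumSubsets-mono (λ s → g≤h (inside ∷ s))) (sumSubsets-mono (λ s → g≤h (outside ∷ s)))

sumSubsets-+ : ∀ {n} (g h : Subset n → ℕ) → sumSubsets (λ s → g s + h s) ≡ sumSubsets g + sumSubsets h
sumSubsets-+ {zero} g h = refl
sumSubsets-+ {suc n} g h =
  trans (cong₂ _+_ (sumSubsets-+ (λ s → g (inside ∷ s)) (λ s → h (inside ∷ s)))
                   (sumSubsets-+ (λ s → g (outside ∷ s)) (λ s → h (outside ∷ s))))
        (interchange (sumSubsets (λ s → g (inside ∷ s))) (sumSubsets (λ s → h (inside ∷ s)))
                     (sumSubsets (λ s → g (outside ∷ s))) (sumSubsets (λ s → h (outside ∷ s))))

_≟ˢ_ : ∀ {n} → DecidableEquality (Subset n)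
_≟ˢ_ = ≡-dec Bool._≟_

-- count is opaque: it is used only through the lemmas of this block, and opacity lets Agda read
-- off the counted predicate from a goal  count p ≤ …  instead of unfolding the sum.
opaque
  count : ∀ {n} → (Subset n → Bool) → ℕ
  count p = sumSubsets (λ s → ind (p s))

  count-mono : ∀ {n} {p q : Subset n → Bool} → (∀ s → T (p s) → T (q s)) → count p ≤ count q
  count-mono {p = p} {q} p⇒q = sumSubsets-mono (λ s → ind-mono (p s) (q s) (p⇒q s))

  count-≤-+ : ∀ {n} {p q r : Subset n → Bool} → (∀ s → ind (p s) ≤ ind (q s) + ind (r s)) →
    count p ≤ count q + count r
  count-≤-+ {q = q} {r} le =
    ≤-trans (sumSubsets-mono le) (≤-reflexive (sumSubsets-+ (λ s → ind (q s)) (λ s → ind (r s))))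

  count-≤-3 : ∀ {n} {p₁ p₂ p₃ q₁ q₂ q₃ : Subset n → Bool} →
    (∀ s → ind (p₁ s) + ind (p₂ s) + ind (p₃ s) ≤ ind (q₁ s) + ind (q₂ s) + ind (q₃ s)) →
    count p₁ + count p₂ + count p₃ ≤ count q₁ + count q₂ + count q₃
  count-≤-3 {n} {p₁} {p₂} {p₃} {q₁} {q₂} {q₃} le = begin
    count p₁ + count p₂ + count p₃                           ≡⟨ sum3 p₁ p₂ p₃ ⟨
    sumSubsets (λ s → ind (p₁ s) + ind (p₂ s) + ind (p₃ s))  ≤⟨ sumSubsets-mono le ⟩
    sumSubsets (λ s → ind (q₁ s) + ind (q₂ s) + ind (q₃ s))  ≡⟨ sum3 q₁ q₂ q₃ ⟩
    count q₁ + count q₂ + count q₃                           ∎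
    where
    open ≤-Reasoning
    sum3 : ∀ (r₁ r₂ r₃ : Subset n → Bool) →
      sumSubsets (λ s → ind (r₁ s) + ind (r₂ s) + ind (r₃ s)) ≡ count r₁ + count r₂ + count r₃
    sum3 r₁ r₂ r₃ = trans (sumSubsets-+ (λ s → ind (r₁ s) + ind (r₂ s)) (λ s → ind (r₃ s)))
                          (cong₂ _+_ (sumSubsets-+ (λ s → ind (r₁ s)) (λ s → ind (r₂ s))) refl)

  count-split : ∀ {n} (p q : Subset n → Bool) →
    count p ≡ count (λ s → q s ∧ p s) + count (λ s → p s ∧ not (q s))
  count-split p q = trans (sumSubsets-cong (λ s → split (p s) (q s)))
                          (sumSubsets-+ (λ s → ind (q s ∧ p s)) (λ s → ind (p s ∧ not (q s))))
    where
    split : ∀ a b → ind a ≡ ind (b ∧ a) + ind (a ∧ not b)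
    split false false = refl
    split false true = refl
    split true false = refl
    split true true = refl

  count-false : ∀ {n} → count {n} (λ _ → false) ≡ 0
  count-false {zero} = refl
  count-false {suc n} = cong₂ _+_ (count-false {n}) (count-false {n})

  count-singleton : ∀ {n} (t : Subset n) → count (λ s → does (s ≟ˢ t)) ≡ 1
  count-singleton [] = refl
  count-singleton {suc n} (inside ∷ t) = cong₂ _+_ (count-singleton t) (count-false {n})
  count-singleton {suc n} (outside ∷ t) = cong₂ _+_ (count-false {n}) (count-singleton t)

  witness : ∀ {n} (p : Subset n → Bool) → 1 ≤ count p → ∃ λ s → T (p s)
  witness {zero} p _ with p [] in p[]
  ... | true = [] , subst T (sym p[]) tt
  witness {suc n} p 1≤count with count (λ s → p (inside ∷ s)) in count-inside
  ... | zero = Product.map (outside ∷_) id (witness (λ s → p (outside ∷ s)) 1≤count)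
  ... | suc _ = Product.map (inside ∷_) id
                  (witness (λ s → p (inside ∷ s)) (≤-trans (s≤s z≤n) (≤-reflexive (sym count-inside))))

_without_ : ∀ {n} → (Subset n → Bool) → Subset n → (Subset n → Bool)
(p without t) s = p s ∧ not (does (s ≟ˢ t))

without-spec : ∀ {n} (p : Subset n → Bool) {t s} → T ((p without t) s) → T (p s) × s ≢ t
without-spec p {t} {s} ps∧s≢t with s ≟ˢ t
... | yes _ = ⊥-elim (proj₂ (Equivalence.to Bool.T-∧ ps∧s≢t))
... | no s≢t = proj₁ (Equivalence.to Bool.T-∧ ps∧s≢t) , s≢t

count-without : ∀ {n k} (p : Subset n → Bool) t → suc k ≤ count p → k ≤ count (p without t)
count-without {k = k} p t 1+k≤count = ≤-pred (begin
  suc k                                                    ≤⟨ 1+k≤count ⟩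
  count p                                                  ≡⟨ count-split p (λ s → does (s ≟ˢ t)) ⟩
  count (λ s → does (s ≟ˢ t) ∧ p s) + count (p without t)  ≤⟨ +-monoˡ-≤ (count (p without t)) at-most-t ⟩
  1 + count (p without t)                                  ∎)
  where
  open ≤-Reasoning
  at-most-t : count (λ s → does (s ≟ˢ t) ∧ p s) ≤ 1
  at-most-t = ≤-trans (count-mono {q = λ s → does (s ≟ˢ t)} (λ s h → proj₁ (Equivalence.to Bool.T-∧ h)))
                      (≤-reflexive (count-singleton t))

ThreeDistinct : ∀ {n} → (Subset n → Bool) → Set
ThreeDistinct {n} p = Σ (Subset n) λ s₁ → Σ (Subset n) λ s₂ → Σ (Subset n) λ s₃ →
  s₁ ≢ s₂ × s₁ ≢ s₃ × s₂ ≢ s₃ × T (p s₁) × T (p s₂) × T (p s₃)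

three-witnesses : ∀ {n} (p : Subset n → Bool) → 3 ≤ count p → ThreeDistinct p
three-witnesses p 3≤count with witness p (≤-trans (s≤s z≤n) 3≤count)
... | s₁ , p-s₁ with witness (p without s₁) (≤-trans (s≤s z≤n) (count-without p s₁ 3≤count))
... | s₂ , p′-s₂ with witness ((p without s₁) without s₂) (count-without _ s₂ (count-without p s₁ 3≤count))
... | s₃ , p″-s₃ =
  let (p′-s₃ , s₃≢s₂) = without-spec (p without s₁) p″-s₃
      (p-s₃ , s₃≢s₁) = without-spec p p′-s₃
      (p-s₂ , s₂≢s₁) = without-spec p p′-s₂
  in s₁ , s₂ , s₃ , (λ e → s₂≢s₁ (sym e)) , (λ e → s₃≢s₁ (sym e)) , (λ e → s₃≢s₂ (sym e)) , p-s₁ , p-s₂ , p-s₃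

-- 2. Sizes of subsets.

∣∪∣+∣∩∣ : ∀ {n} (p q : Subset n) → ∣ p ∪ q ∣ + ∣ p ∩ q ∣ ≡ ∣ p ∣ + ∣ q ∣
∣∪∣+∣∩∣ [] [] = refl
∣∪∣+∣∩∣ (inside ∷ p) (inside ∷ q) =
  cong suc (trans (+-suc ∣ p ∪ q ∣ ∣ p ∩ q ∣) (trans (cong suc (∣∪∣+∣∩∣ p q)) (sym (+-suc ∣ p ∣ ∣ q ∣))))
∣∪∣+∣∩∣ (inside ∷ p) (outside ∷ q) = cong suc (∣∪∣+∣∩∣ p q)
∣∪∣+∣∩∣ (outside ∷ p) (inside ∷ q) = trans (cong suc (∣∪∣+∣∩∣ p q)) (sym (+-suc ∣ p ∣ ∣ q ∣))
∣∪∣+∣∩∣ (outside ∷ p) (outside ∷ q) = ∣∪∣+∣∩∣ p q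

∣∪∣≤ : ∀ {n} (p q : Subset n) → ∣ p ∪ q ∣ ≤ ∣ p ∣ + ∣ q ∣
∣∪∣≤ p q = ≤-trans (m≤m+n ∣ p ∪ q ∣ ∣ p ∩ q ∣) (≤-reflexive (∣∪∣+∣∩∣ p q))

∪-least : ∀ {n} {X Z L : Subset n} → X ⊆ L → Z ⊆ L → X ∪ Z ⊆ L
∪-least {X = X} {Z} X⊆L Z⊆L x∈X∪Z with x∈p∪q⁻ X Z x∈X∪Z
... | inj₁ x∈X = X⊆L x∈X
... | inj₂ x∈Z = Z⊆L x∈Z

⊆-card : ∀ {n} {X L : Subset n} → X ⊆ L → ∣ L ∣ ≤ ∣ X ∣ → X ≡ L
⊆-card {X = []} {[]} _ _ = refl
⊆-card {X = inside ∷ X} {inside ∷ L} X⊆L (s≤s ∣L∣≤∣X∣) = cong (inside ∷_) (⊆-card (drop-∷-⊆ X⊆L) ∣L∣≤∣X∣)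
⊆-card {X = inside ∷ X} {outside ∷ L} X⊆L _ with X⊆L here
... | ()
⊆-card {X = outside ∷ X} {inside ∷ L} X⊆L 1+∣L∣≤∣X∣ =
  ⊥-elim (<-irrefl refl (≤-trans 1+∣L∣≤∣X∣ (p⊆q⇒∣p∣≤∣q∣ (drop-∷-⊆ X⊆L))))
⊆-card {X = outside ∷ X} {outside ∷ L} X⊆L ∣L∣≤∣X∣ = cong (outside ∷_) (⊆-card (drop-∷-⊆ X⊆L) ∣L∣≤∣X∣)

pairs-≡ : ∀ {n} {P t : Subset n} → ∣ P ∣ ≡ 2 → ∣ t ∣ ≡ 2 → 2 ≤ ∣ P ∩ t ∣ → P ≡ t
pairs-≡ {P = P} {t} ∣P∣≡2 ∣t∣≡2 2≤∣P∩t∣ = begin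
  P      ≡⟨ sym (⊆-card (p∩q⊆p P t) (subst (_≤ ∣ P ∩ t ∣) (sym ∣P∣≡2) 2≤∣P∩t∣)) ⟩
  P ∩ t  ≡⟨ ∩-comm P t ⟩
  t ∩ P  ≡⟨ ⊆-card (p∩q⊆p t P) (subst₂ _≤_ (sym ∣t∣≡2) (cong ∣_∣ (∩-comm P t)) 2≤∣P∩t∣) ⟩
  t      ∎
  where open ≡-Reasoning

pairs-∪ : ∀ {n} {X Z : Subset n} → ∣ X ∣ ≡ 2 → ∣ Z ∣ ≡ 2 → X ≢ Z → 3 ≤ ∣ X ∪ Z ∣
pairs-∪ {X = X} {Z} ∣X∣≡2 ∣Z∣≡2 X≢Z with 3 ≤? ∣ X ∪ Z ∣
... | yes 3≤∣X∪Z∣ = 3≤∣X∪Z∣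
... | no 3≰∣X∪Z∣ = ⊥-elim (X≢Z (trans (absorbs (p⊆p∪q Z) ∣X∣≡2) (sym (absorbs (q⊆p∪q X Z) ∣Z∣≡2))))
  where
  absorbs : ∀ {W} → W ⊆ X ∪ Z → ∣ W ∣ ≡ 2 → W ≡ X ∪ Z
  absorbs W⊆X∪Z ∣W∣≡2 = ⊆-card W⊆X∪Z (subst (∣ X ∪ Z ∣ ≤_) (sym ∣W∣≡2) (≤-pred (≰⇒> 3≰∣X∪Z∣)))

-- 3. Free pairs.

Disjoint : ∀ {n} → Subset n → Subset n → Set
Disjoint p q = ∀ {x} → x ∈ p → x ∉ q

Disjoint⇒∣∩∣≡0 : ∀ {n} {p q : Subset n} → Disjoint p q → ∣ p ∩ q ∣ ≡ 0
Disjoint⇒∣∩∣≡0 {n} {p} {q} disj =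
  trans (cong ∣_∣ (Empty-unique λ (x , x∈p∩q) → let (x∈p , x∈q) = x∈p∩q⁻ p q x∈p∩q in disj x∈p x∈q))
        (∣⊥∣≡0 n)

Disjoint-∪ : ∀ {n} {s X Z : Subset n} → Disjoint s X → Disjoint s Z → Disjoint s (X ∪ Z)
Disjoint-∪ {X = X} {Z} s∩X=∅ s∩Z=∅ x∈s x∈X∪Z with x∈p∪q⁻ X Z x∈X∪Z
... | inj₁ x∈X = s∩X=∅ x∈s x∈X
... | inj₂ x∈Z = s∩Z=∅ x∈s x∈Z

Disjoint-⊆ : ∀ {n} {s X Z : Subset n} → Z ⊆ X → Disjoint s X → Disjoint s Z
Disjoint-⊆ Z⊆X s∩X=∅ x∈s x∈Z = s∩X=∅ x∈s (Z⊆X x∈Z)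

avoids : ∀ {n} → Subset n → Subset n → Bool
avoids [] [] = true
avoids (inside ∷ s) (a ∷ A) = not a ∧ avoids s A
avoids (outside ∷ s) (_ ∷ A) = avoids s A

avoids-sound : ∀ {n} (s A : Subset n) → T (avoids s A) → Disjoint s A
avoids-sound (inside ∷ s) (inside ∷ A) () here here
avoids-sound (inside ∷ s) (outside ∷ A) h (there x∈s) (there x∈A) = avoids-sound s A h x∈s x∈A
avoids-sound (outside ∷ s) (_ ∷ A) h (there x∈s) (there x∈A) = avoids-sound s A h x∈s x∈A

avoids-complete : ∀ {n} (s A : Subset n) → Disjoint s A → T (avoids s A)
avoids-complete [] [] _ = tt
avoids-complete (inside ∷ s) (inside ∷ A) disj = ⊥-elim (disj here here)
avoids-complete (inside ∷ s) (outside ∷ A) disj = avoids-complete s A (λ x∈s x∈A → disj (there x∈s) (there x∈A))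
avoids-complete (outside ∷ s) (_ ∷ A) disj = avoids-complete s A (λ x∈s x∈A → disj (there x∈s) (there x∈A))

opaque
  unfolding count
  count-avoiding : ∀ {n} k (A : Subset n) → count (λ s → avoids s A ∧ (∣ s ∣ ≡ᵇ k)) ≡ ∣ ∁ A ∣ choose k
  count-avoiding zero [] = refl
  count-avoiding (suc k) [] = refl
  count-avoiding {suc n} k (inside ∷ A) = cong₂ _+_ (count-false {n}) (count-avoiding k A)
  count-avoiding {suc n} zero (outside ∷ A) =
    cong₂ _+_ (trans (sumSubsets-cong (λ s → cong ind (Bool.∧-zeroʳ (avoids s A)))) (count-false {n}))
              (count-avoiding zero A)
  count-avoiding (suc k) (outside ∷ A) =
    trans (cong₂ _+_ (count-avoiding k A) (count-avoiding (suc k) A)) (nCk+nC[k+1]≡[n+1]C[k+1] ∣ ∁ A ∣ k)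

choose-mono : ∀ {m m′} k → m ≤ m′ → m choose k ≤ m′ choose k
choose-mono {m} k m≤m′ = go (≤⇒≤′ m≤m′)
  where
  pascal : ∀ j i → j choose i ≤ suc j choose i
  pascal j zero = ≤-refl
  pascal j (suc i) =
    subst (j choose suc i ≤_) (nCk+nC[k+1]≡[n+1]C[k+1] j i) (m≤n+m (j choose suc i) (j choose i))
  go : ∀ {j} → m ≤′ j → m choose k ≤ j choose k
  go ≤′-refl = ≤-refl
  go (≤′-step m≤′j) = ≤-trans (go m≤′j) (pascal _ k)

freePair : ∀ {n} → Subset n → Subset n → Bool
freePair A s = avoids s A ∧ (∣ s ∣ ≡ᵇ 2)

freePair-elim : ∀ {n} {A s : Subset n} → T (freePair A s) → Disjoint s A × ∣ s ∣ ≡ 2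
freePair-elim {A = A} {s} free with Equivalence.to Bool.T-∧ free
... | avoid , size = avoids-sound s A avoid , ≡ᵇ⇒≡ ∣ s ∣ 2 size

freePair-intro : ∀ {n} {A s : Subset n} → Disjoint s A → ∣ s ∣ ≡ 2 → T (freePair A s)
freePair-intro {A = A} {s} disj ∣s∣≡2 = Equivalence.from Bool.T-∧ (avoids-complete s A disj , ≡⇒≡ᵇ ∣ s ∣ 2 ∣s∣≡2)

freePair-∪ : ∀ {n} {L X Z : Subset n} C s → L ⊆ X ∪ Z →
  T (freePair (X ∪ C) s) → T (freePair (Z ∪ C) s) → T (freePair (L ∪ C) s)
freePair-∪ {L = L} {X} {Z} C s L⊆X∪Z free-X free-Z
  with freePair-elim {A = X ∪ C} {s} free-X | freePair-elim {A = Z ∪ C} {s} free-Z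
... | s∩XC=∅ , ∣s∣≡2 | s∩ZC=∅ , _ =
  freePair-intro {A = L ∪ C} {s} (Disjoint-∪ (Disjoint-⊆ L⊆X∪Z (Disjoint-∪ s∩X=∅ s∩Z=∅)) s∩C=∅) ∣s∣≡2
  where
  s∩X=∅ = Disjoint-⊆ (p⊆p∪q C) s∩XC=∅
  s∩Z=∅ = Disjoint-⊆ (p⊆p∪q C) s∩ZC=∅
  s∩C=∅ = Disjoint-⊆ (q⊆p∪q X C) s∩XC=∅

freePairs-≥ : ∀ {n} (A : Subset n) m → m + ∣ A ∣ ≤ n → m choose 2 ≤ count (freePair A)
freePairs-≥ A m m+∣A∣≤n = subst (m choose 2 ≤_) (sym (count-avoiding 2 A))
  (choose-mono 2 (subst (m ≤_) (sym (∣∁p∣≡n∸∣p∣ A)) (m+n≤o⇒m≤o∸n m m+∣A∣≤n)))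

freePairs-≤ : ∀ {n} (A : Subset n) m → n ≤ ∣ A ∣ + m → count (freePair A) ≤ m choose 2
freePairs-≤ {n} A m n≤∣A∣+m = subst (_≤ m choose 2) (sym (count-avoiding 2 A))
  (choose-mono 2 (subst (_≤ m) (sym (∣∁p∣≡n∸∣p∣ A)) (m≤n+o⇒m∸n≤o n ∣ A ∣ n≤∣A∣+m)))

-- 4. Valid and obstructed labels.  With colours A blocked at the neighbours of v and the labels
-- Y of the relevant second-neighbours forbidden, a free pair is obstructed if it is listed in Y
-- and valid otherwise.

listed : ∀ {n} → List (Subset n) → Subset n → Bool
listed Y s = does (DecMembership._∈?_ _≟ˢ_ s Y)

listed-complete : ∀ {n} {Y : List (Subset n)} {t} → t ∈ˡ Y → T (listed Y t)
listed-complete {Y = Y} {t} t∈Y = subst T (sym (dec-true (DecMembership._∈?_ _≟ˢ_ t Y) t∈Y)) tt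

count-listed : ∀ {n} (Y : List (Subset n)) → count (listed Y) ≤ length Y
count-listed {n} [] = ≤-reflexive (count-false {n})
count-listed (t ∷ Y) = ≤-trans (count-≤-+ (λ s → ind-∨ (does (s ≟ˢ t)) (listed Y s)))
                               (+-mono-≤ (≤-reflexive (count-singleton t)) (count-listed Y))
  where
  ind-∨ : ∀ a b → ind (a ∨ b) ≤ ind a + ind b
  ind-∨ false b = ≤-refl
  ind-∨ true b = s≤s z≤n

valid obstructed : ∀ {n} → Subset n → List (Subset n) → Subset n → Bool
valid A Y s = freePair A s ∧ not (listed Y s)
obstructed A Y s = listed Y s ∧ freePair A s

freePair-split : ∀ {n} (A : Subset n) Y → count (freePair A) ≡ count (obstructed A Y) + count (valid A Y)
freePair-split A Y = count-split (freePair A) (listed Y)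

count-obstructed : ∀ {n} (A : Subset n) Y → count (obstructed A Y) ≤ length Y
count-obstructed A Y =
  ≤-trans (count-mono {p = obstructed A Y} (λ s h → proj₁ (Equivalence.to Bool.T-∧ h))) (count-listed Y)

-- With at most five forbidden labels, at most two valid labels force at least four blocked
-- colours: with at most three there are C(5, 2) = 10 free pairs, at most 5 + 2 of them used.
-- (A false inequality between numerals is refuted by evaluating  ≤ᵇ.)
fewValid⇒crowded : ∀ (A : Subset 8) Y → length Y ≤ 5 → count (valid A Y) ≤ 2 → 4 ≤ ∣ A ∣
fewValid⇒crowded A Y ∣Y∣≤5 few with 4 ≤? ∣ A ∣
... | yes 4≤∣A∣ = 4≤∣A∣
... | no 4≰∣A∣ = ⊥-elim (≤⇒≤ᵇ (begin
  5 choose 2                                  ≤⟨ freePairs-≥ A 5 (+-monoʳ-≤ 5 (≤-pred (≰⇒> 4≰∣A∣))) ⟩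
  count (freePair A)                          ≡⟨ freePair-split A Y ⟩
  count (obstructed A Y) + count (valid A Y)  ≤⟨ +-mono-≤ (≤-trans (count-obstructed A Y) ∣Y∣≤5) few ⟩
  7                                           ∎))
  where open ≤-Reasoning

fewValid⇒manyObstructed : ∀ (A : Subset 8) Y → ∣ A ∣ ≤ 4 → count (valid A Y) ≤ 2 → 4 ≤ count (obstructed A Y)
fewValid⇒manyObstructed A Y ∣A∣≤4 few = +-cancelʳ-≤ 2 4 (count (obstructed A Y)) (begin
  4 choose 2                                  ≤⟨ freePairs-≥ A 4 (+-monoʳ-≤ 4 ∣A∣≤4) ⟩
  count (freePair A)                          ≡⟨ freePair-split A Y ⟩
  count (obstructed A Y) + count (valid A Y)  ≤⟨ +-monoʳ-≤ (count (obstructed A Y)) few ⟩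
  count (obstructed A Y) + 2                  ∎)
  where open ≤-Reasoning

-- Pointwise bounds on how often a pair is obstructed for three colour sets A₁, A₂, A₃.  Here
-- y says that the pair is forbidden, aᵢ that it is free for Aᵢ, and a that it is free for
-- A₁ ∪ A₂ ∪ A₃.  A pair free for all three is free for the union; if moreover any two of the
-- Aᵢ already cover the union, a pair free for two is free for the union.
ind≤1 : ∀ a → ind a ≤ 1
ind≤1 false = z≤n
ind≤1 true = ≤-refl

atMost3 : ∀ a₁ a₂ a₃ → ind a₁ + ind a₂ + ind a₃ ≤ 3
atMost3 a₁ a₂ a₃ = +-mono-≤ (+-mono-≤ (ind≤1 a₁) (ind≤1 a₂)) (ind≤1 a₃)

tripleBound : ∀ y a₁ a₂ a₃ a → (T a₁ → T a₂ → T a₃ → T a) →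
  ind (y ∧ a₁) + ind (y ∧ a₂) + ind (y ∧ a₃) ≤ ind y + ind y + ind a
tripleBound false _ _ _ _ _ = z≤n
tripleBound true a₁ a₂ a₃ true _ = atMost3 a₁ a₂ a₃
tripleBound true true true true false all = ⊥-elim (all tt tt tt)
tripleBound true true true false false _ = ≤-refl
tripleBound true true false a₃ false _ = s≤s (ind≤1 a₃)
tripleBound true false a₂ a₃ false _ = +-mono-≤ (ind≤1 a₂) (ind≤1 a₃)

pairBound : ∀ y a₁ a₂ a₃ a → (T a₁ → T a₂ → T a) → (T a₁ → T a₃ → T a) → (T a₂ → T a₃ → T a) →
  ind (y ∧ a₁) + ind (y ∧ a₂) + ind (y ∧ a₃) ≤ ind y + ind a + ind a
pairBound false _ _ _ _ _ _ _ = z≤n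
pairBound true a₁ a₂ a₃ true _ _ _ = atMost3 a₁ a₂ a₃
pairBound true true true _ false h₁₂ _ _ = ⊥-elim (h₁₂ tt tt)
pairBound true true false true false _ h₁₃ _ = ⊥-elim (h₁₃ tt tt)
pairBound true true false false false _ _ _ = ≤-refl
pairBound true false true true false _ _ h₂₃ = ⊥-elim (h₂₃ tt tt)
pairBound true false true false false _ _ _ = ≤-refl
pairBound true false false a₃ false _ _ _ = ind≤1 a₃

-- 5. The counting theorem.  Three distinct labels L₁, L₂, L₃ that w₁ may receive, the colours
-- C of the remaining coloured neighbour of v, and at most five forbidden labels Y.
module ThreeLabels (L₁ L₂ L₃ C : Subset 8) (Y : List (Subset 8))
  (∣L₁∣≡2 : ∣ L₁ ∣ ≡ 2) (∣L₂∣≡2 : ∣ L₂ ∣ ≡ 2) (∣L₃∣≡2 : ∣ L₃ ∣ ≡ 2)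
  (L₁≢L₂ : L₁ ≢ L₂) (L₁≢L₃ : L₁ ≢ L₃) (L₂≢L₃ : L₂ ≢ L₃)
  (∣C∣≤2 : ∣ C ∣ ≤ 2) (∣Y∣≤5 : length Y ≤ 5) where

  L : Subset 8
  L = L₁ ∪ (L₂ ∪ L₃)

  L₁⊆L : L₁ ⊆ L
  L₁⊆L = p⊆p∪q (L₂ ∪ L₃)
  L₂⊆L : L₂ ⊆ L
  L₂⊆L x∈L₂ = q⊆p∪q L₁ (L₂ ∪ L₃) (p⊆p∪q L₃ x∈L₂)
  L₃⊆L : L₃ ⊆ L
  L₃⊆L x∈L₃ = q⊆p∪q L₁ (L₂ ∪ L₃) (q⊆p∪q L₂ L₃ x∈L₃)

  3≤∣L∣ : 3 ≤ ∣ L ∣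
  3≤∣L∣ = ≤-trans (pairs-∪ ∣L₁∣≡2 ∣L₂∣≡2 L₁≢L₂) (p⊆q⇒∣p∣≤∣q∣ (∪-least L₁⊆L L₂⊆L))

  coveredByTwo : ∣ L ∣ ≤ 3 → ∀ {X Z} → ∣ X ∣ ≡ 2 → ∣ Z ∣ ≡ 2 → X ≢ Z → X ⊆ L → Z ⊆ L → L ⊆ X ∪ Z
  coveredByTwo ∣L∣≤3 ∣X∣≡2 ∣Z∣≡2 X≢Z X⊆L Z⊆L =
    subst (L ⊆_) (sym (⊆-card (∪-least X⊆L Z⊆L) (≤-trans ∣L∣≤3 (pairs-∪ ∣X∣≡2 ∣Z∣≡2 X≢Z)))) (λ x∈L → x∈L)

  allFree : ∀ s → T (freePair (L₁ ∪ C) s) → T (freePair (L₂ ∪ C) s) → T (freePair (L₃ ∪ C) s) →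
    T (freePair (L ∪ C) s)
  allFree s free₁ free₂ free₃ = freePair-∪ C s (λ x∈L → x∈L) free₁ (freePair-∪ C s (λ x∈L → x∈L) free₂ free₃)

  crowded⇒apart : ∀ X → ∣ X ∣ ≡ 2 → 4 ≤ ∣ X ∪ C ∣ → ∣ X ∩ C ∣ ≡ 0 × ∣ C ∣ ≡ 2
  crowded⇒apart X ∣X∣≡2 4≤∣X∪C∣ =
    n≤0⇒n≡0 (+-cancelˡ-≤ 4 ∣ X ∩ C ∣ 0 noOverlap) , ≤-antisym ∣C∣≤2 (+-cancelˡ-≤ 2 2 ∣ C ∣ 4≤2+∣C∣)
    where
    open ≤-Reasoning
    incl-excl : ∣ X ∪ C ∣ + ∣ X ∩ C ∣ ≡ 2 + ∣ C ∣
    incl-excl = trans (∣∪∣+∣∩∣ X C) (cong (_+ ∣ C ∣) ∣X∣≡2)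
    noOverlap : 4 + ∣ X ∩ C ∣ ≤ 4 + 0
    noOverlap = begin
      4 + ∣ X ∩ C ∣          ≤⟨ +-monoˡ-≤ ∣ X ∩ C ∣ 4≤∣X∪C∣ ⟩
      ∣ X ∪ C ∣ + ∣ X ∩ C ∣  ≡⟨ incl-excl ⟩
      2 + ∣ C ∣              ≤⟨ +-monoʳ-≤ 2 ∣C∣≤2 ⟩
      4                      ∎
    4≤2+∣C∣ : 2 + 2 ≤ 2 + ∣ C ∣
    4≤2+∣C∣ = begin
      4                      ≤⟨ 4≤∣X∪C∣ ⟩
      ∣ X ∪ C ∣              ≤⟨ m≤m+n ∣ X ∪ C ∣ ∣ X ∩ C ∣ ⟩
      ∣ X ∪ C ∣ + ∣ X ∩ C ∣  ≡⟨ incl-excl ⟩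
      2 + ∣ C ∣              ∎

  listed≤5 : count (listed Y) ≤ 5
  listed≤5 = ≤-trans (count-listed Y) ∣Y∣≤5

  module Crowded (c₁ : 4 ≤ ∣ L₁ ∪ C ∣) (c₂ : 4 ≤ ∣ L₂ ∪ C ∣) (c₃ : 4 ≤ ∣ L₃ ∪ C ∣) where

    ∣L∩C∣≡0 : ∣ L ∩ C ∣ ≡ 0
    ∣L∩C∣≡0 = n≤0⇒n≡0 (begin
      ∣ L ∩ C ∣                               ≡⟨ cong ∣_∣ distrib ⟩
      ∣ (L₁ ∩ C) ∪ ((L₂ ∩ C) ∪ (L₃ ∩ C)) ∣    ≤⟨ ∣∪∣≤ (L₁ ∩ C) ((L₂ ∩ C) ∪ (L₃ ∩ C)) ⟩
      ∣ L₁ ∩ C ∣ + ∣ (L₂ ∩ C) ∪ (L₃ ∩ C) ∣    ≤⟨ +-monoʳ-≤ ∣ L₁ ∩ C ∣ (∣∪∣≤ (L₂ ∩ C) (L₃ ∩ C)) ⟩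
      ∣ L₁ ∩ C ∣ + (∣ L₂ ∩ C ∣ + ∣ L₃ ∩ C ∣)  ≡⟨ cong₂ _+_ (apart L₁ ∣L₁∣≡2 c₁)
                                                   (cong₂ _+_ (apart L₂ ∣L₂∣≡2 c₂) (apart L₃ ∣L₃∣≡2 c₃)) ⟩
      0                                       ∎)
      where
      open ≤-Reasoning
      apart : ∀ X → ∣ X ∣ ≡ 2 → 4 ≤ ∣ X ∪ C ∣ → ∣ X ∩ C ∣ ≡ 0
      apart X ∣X∣≡2 c = proj₁ (crowded⇒apart X ∣X∣≡2 c)
      distrib : L ∩ C ≡ (L₁ ∩ C) ∪ ((L₂ ∩ C) ∪ (L₃ ∩ C))
      distrib = trans (∩-distribʳ-∪ C L₁ (L₂ ∪ L₃)) (cong ((L₁ ∩ C) ∪_) (∩-distribʳ-∪ C L₂ L₃))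

    ∣L∪C∣≡∣L∣+2 : ∣ L ∪ C ∣ ≡ ∣ L ∣ + 2
    ∣L∪C∣≡∣L∣+2 = begin
      ∣ L ∪ C ∣              ≡⟨ +-identityʳ ∣ L ∪ C ∣ ⟨
      ∣ L ∪ C ∣ + 0          ≡⟨ cong (∣ L ∪ C ∣ +_) ∣L∩C∣≡0 ⟨
      ∣ L ∪ C ∣ + ∣ L ∩ C ∣  ≡⟨ ∣∪∣+∣∩∣ L C ⟩
      ∣ L ∣ + ∣ C ∣          ≡⟨ cong (∣ L ∣ +_) (proj₂ (crowded⇒apart L₁ ∣L₁∣≡2 c₁)) ⟩
      ∣ L ∣ + 2              ∎
      where open ≡-Reasoning

    -- If |L| ≥ 4, at most C(2, 2) = 1 pair avoids L ∪ C; if |L| = 3, at most C(3, 2) = 3 do,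
    -- and a pair free for two of the Lᵢ ∪ C is among them.
    obstructionBudget :
      count (obstructed (L₁ ∪ C) Y) + count (obstructed (L₂ ∪ C) Y) + count (obstructed (L₃ ∪ C) Y) ≤ 11
    obstructionBudget with 4 ≤? ∣ L ∣
    ... | yes 4≤∣L∣ = begin
      count (obstructed (L₁ ∪ C) Y) + count (obstructed (L₂ ∪ C) Y) + count (obstructed (L₃ ∪ C) Y)
        ≤⟨ count-≤-3 (λ s → tripleBound (listed Y s) _ _ _ _ (allFree s)) ⟩
      count (listed Y) + count (listed Y) + count (freePair (L ∪ C))
        ≤⟨ +-mono-≤ (+-mono-≤ listed≤5 listed≤5) (freePairs-≤ (L ∪ C) 2 8≤∣L∪C∣+2) ⟩
      5 + 5 + 2 choose 2
        ∎
      where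
      open ≤-Reasoning
      8≤∣L∪C∣+2 : 8 ≤ ∣ L ∪ C ∣ + 2
      8≤∣L∪C∣+2 = subst (λ k → 8 ≤ k + 2) (sym ∣L∪C∣≡∣L∣+2) (+-monoˡ-≤ 2 (+-monoˡ-≤ 2 4≤∣L∣))
    ... | no 4≰∣L∣ = begin
      count (obstructed (L₁ ∪ C) Y) + count (obstructed (L₂ ∪ C) Y) + count (obstructed (L₃ ∪ C) Y)
        ≤⟨ count-≤-3 (λ s → pairBound (listed Y s) _ _ _ _
             (freePair-∪ C s (cover ∣L₁∣≡2 ∣L₂∣≡2 L₁≢L₂ L₁⊆L L₂⊆L))
             (freePair-∪ C s (cover ∣L₁∣≡2 ∣L₃∣≡2 L₁≢L₃ L₁⊆L L₃⊆L))
             (freePair-∪ C s (cover ∣L₂∣≡2 ∣L₃∣≡2 L₂≢L₃ L₂⊆L L₃⊆L))) ⟩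
      count (listed Y) + count (freePair (L ∪ C)) + count (freePair (L ∪ C))
        ≤⟨ +-mono-≤ (+-mono-≤ listed≤5 few) few ⟩
      5 + 3 choose 2 + 3 choose 2
        ∎
      where
      open ≤-Reasoning
      cover = coveredByTwo (≤-pred (≰⇒> 4≰∣L∣))
      8≤∣L∪C∣+3 : 8 ≤ ∣ L ∪ C ∣ + 3
      8≤∣L∪C∣+3 = subst (λ k → 8 ≤ k + 3) (sym ∣L∪C∣≡∣L∣+2) (+-monoˡ-≤ 3 (+-monoˡ-≤ 2 3≤∣L∣))
      few : count (freePair (L ∪ C)) ≤ 3 choose 2
      few = freePairs-≤ (L ∪ C) 3 8≤∣L∪C∣+3

  -- For one of the three labels of w₁, v has at least three valid labels: otherwise every
  -- Lᵢ ∪ C is crowded and each of the three counts of obstructions is at least 4.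
  someLabelHasThree :
    3 ≤ count (valid (L₁ ∪ C) Y) ⊎ 3 ≤ count (valid (L₂ ∪ C) Y) ⊎ 3 ≤ count (valid (L₃ ∪ C) Y)
  someLabelHasThree
    with 3 ≤? count (valid (L₁ ∪ C) Y) | 3 ≤? count (valid (L₂ ∪ C) Y) | 3 ≤? count (valid (L₃ ∪ C) Y)
  ... | yes three₁ | _ | _ = inj₁ three₁
  ... | no _ | yes three₂ | _ = inj₂ (inj₁ three₂)
  ... | no _ | no _ | yes three₃ = inj₂ (inj₂ three₃)
  ... | no few₁ | no few₂ | no few₃ = ⊥-elim (≤⇒≤ᵇ (begin
    12
      ≤⟨ +-mono-≤ (+-mono-≤ (many L₁ ∣L₁∣≡2 few₁) (many L₂ ∣L₂∣≡2 few₂)) (many L₃ ∣L₃∣≡2 few₃) ⟩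
    count (obstructed (L₁ ∪ C) Y) + count (obstructed (L₂ ∪ C) Y) + count (obstructed (L₃ ∪ C) Y)
      ≤⟨ Crowded.obstructionBudget (crowded L₁ few₁) (crowded L₂ few₂) (crowded L₃ few₃) ⟩
    11
      ∎))
    where
    open ≤-Reasoning
    crowded : ∀ X → ¬ 3 ≤ count (valid (X ∪ C) Y) → 4 ≤ ∣ X ∪ C ∣
    crowded X few = fewValid⇒crowded (X ∪ C) Y ∣Y∣≤5 (≤-pred (≰⇒> few))
    many : ∀ X → ∣ X ∣ ≡ 2 → ¬ 3 ≤ count (valid (X ∪ C) Y) → 4 ≤ count (obstructed (X ∪ C) Y)
    many X ∣X∣≡2 few = fewValid⇒manyObstructed (X ∪ C) Y
      (≤-trans (∣∪∣≤ X C) (+-mono-≤ (≤-reflexive ∣X∣≡2) ∣C∣≤2)) (≤-pred (≰⇒> few))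

-- 6. Walks and relabelling.

module _ {n} {G : Graph n} where

  snocWalk : ∀ {u w z k} → Walk G u w k → Adj G w z → Walk G u z (suc k)
  snocWalk here e = step e here
  snocWalk (step e w) e′ = step e (snocWalk w e′)

  reverseWalk : ∀ {u w k} → Walk G u w k → Walk G w u k
  reverseWalk here = here
  reverseWalk (step e w) = snocWalk (reverseWalk w) (Graph.sym G e)

  <dist-sym : ∀ {m u v} → m <dist[ G ] u , v → m <dist[ G ] v , u
  <dist-sym d j j≤m w = d j j≤m (reverseWalk w)

_[_↦_] : ∀ {n} → PColoring n → Fin n → Subset 8 → PColoring n
(g [ v ↦ P ]) u with u ≟ v
... | yes _ = just P
... | no _ = g u

update-here : ∀ {n} (g : PColoring n) v P → (g [ v ↦ P ]) v ≡ just P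
update-here g v P with v ≟ v
... | yes _ = refl
... | no v≢v = ⊥-elim (v≢v refl)

update-there : ∀ {n} (g : PColoring n) {u v} P → u ≢ v → (g [ v ↦ P ]) u ≡ g u
update-there g {u} {v} P u≢v with u ≟ v
... | yes u≡v = ⊥-elim (u≢v u≡v)
... | no _ = refl

update-differ : ∀ {n} (g : PColoring n) v {P Q} → P ≢ Q → Differ (g [ v ↦ P ]) (g [ v ↦ Q ])
update-differ g v {P} {Q} P≢Q same =
  P≢Q (just-injective (trans (sym (update-here g v P)) (trans (same v) (update-here g v Q))))

update-2tone : ∀ {n} (G : Graph n) (g : PColoring n) v P → Is2Tone8 G g → ∣ P ∣ ≡ 2 →
  (∀ u t → u ≢ v → g u ≡ just t → ∣ P ∩ t ∣ <dist[ G ] v , u) → Is2Tone8 G (g [ v ↦ P ])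
update-2tone G g v P (sizes , separated) ∣P∣≡2 compatible = sizes′ , separated′
  where
  sizes′ : ∀ u s → (g [ v ↦ P ]) u ≡ just s → ∣ s ∣ ≡ 2
  sizes′ u s e with u ≟ v
  ... | yes _ = subst (λ x → ∣ x ∣ ≡ 2) (just-injective e) ∣P∣≡2
  ... | no _ = sizes u s e
  separated′ : ∀ u u′ s t → u ≢ u′ → (g [ v ↦ P ]) u ≡ just s → (g [ v ↦ P ]) u′ ≡ just t →
    ∣ s ∩ t ∣ <dist[ G ] u , u′
  separated′ u u′ s t u≢u′ e e′ with u ≟ v | u′ ≟ v
  ... | yes refl | yes refl = ⊥-elim (u≢u′ refl)
  ... | yes refl | no u′≢v = subst (λ x → ∣ x ∩ t ∣ <dist[ G ] u , u′) (just-injective e) (compatible u′ t u′≢v e′)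
  ... | no u≢v | yes refl =
    subst (λ x → x <dist[ G ] u , u′) (cong ∣_∣ (trans (∩-comm P s) (cong (s ∩_) (just-injective e′))))
          (<dist-sym (compatible u s u≢v e))
  ... | no _ | no _ = separated u u′ s t u≢u′ e e′

module _ {n} (G : Graph n) (g : PColoring n) (v : Fin n) (P : Subset 8)
  (tone : Is2Tone8 G g) (cand : Candidate G g v P) (noObstruction : ∀ u → SecondNbr G u v → g u ≢ just P) where

  apart-from-neighbour : ∀ {u t} → Adj G v u → g u ≡ just t → ∣ P ∩ t ∣ ≡ 0
  apart-from-neighbour {u} {t} adj e = Disjoint⇒∣∩∣≡0 (λ c∈P c∈t → proj₂ cand _ c∈P u t adj e c∈t)

  -- A walk of length j ≤ |P ∩ t| from v to a vertex u labelled t is impossible: j = 0 means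
  -- u = v; j = 1 makes u a neighbour, sharing no colour with P; j = 2 forces P = t, and u is
  -- then a second-neighbour labelled P; j ≥ 3 exceeds |P| = 2.  (False inequalities between
  -- numerals are refuted by evaluating ≤ᵇ.)
  compatible : ∀ u t → u ≢ v → g u ≡ just t → ∣ P ∩ t ∣ <dist[ G ] v , u
  compatible u t u≢v e zero _ here = u≢v refl
  compatible u t u≢v e (suc zero) 1≤∣P∩t∣ (step adj here) =
    ≤⇒≤ᵇ (subst (1 ≤_) (apart-from-neighbour adj e) 1≤∣P∩t∣)
  compatible u t u≢v e (suc (suc zero)) 2≤∣P∩t∣ w =
    noObstruction u (reverseWalk w , farFromV) (subst (λ x → g u ≡ just x) (sym P≡t) e)
    where
    P≡t : P ≡ t
    P≡t = pairs-≡ (proj₁ cand) (proj₁ tone u t e) 2≤∣P∩t∣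
    farFromV : 1 <dist[ G ] u , v
    farFromV zero _ here = u≢v refl
    farFromV (suc zero) _ (step adj here) =
      ≤⇒≤ᵇ (subst (1 ≤_) (apart-from-neighbour (Graph.sym G adj) e) (≤-trans (s≤s z≤n) 2≤∣P∩t∣))
    farFromV (suc (suc _)) (s≤s ()) _
  compatible u t u≢v e (suc (suc (suc j))) 3+j≤∣P∩t∣ _ =
    ≤⇒≤ᵇ (begin
      3          ≤⟨ s≤s (s≤s (s≤s z≤n)) ⟩
      3 + j      ≤⟨ 3+j≤∣P∩t∣ ⟩
      ∣ P ∩ t ∣  ≤⟨ ∣p∩q∣≤∣p∣ P t ⟩
      ∣ P ∣      ≡⟨ proj₁ cand ⟩
      2          ∎)
    where open ≤-Reasoning

  candidate-extends : g v ≡ nothing → Extension G g (g [ v ↦ P ]) v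
  candidate-extends gv≡nothing =
    update-2tone G g v P tone (proj₁ cand) compatible ,
    gv≡nothing ,
    subst Is-just (sym (update-here g v P)) (MaybeAny.just tt) ,
    λ u u≢v → update-there g P u≢v

-- 8. Neighbourhoods in cubic graphs.

OneOf3 : ∀ {n} → Fin n → Fin n → Fin n → Fin n → Set
OneOf3 u a b c = u ≡ a ⊎ u ≡ b ⊎ u ≡ c

module _ {n} {u a b c : Fin n} where

  swap₁₂ : OneOf3 u a b c → OneOf3 u b a c
  swap₁₂ (inj₁ e) = inj₂ (inj₁ e)
  swap₁₂ (inj₂ (inj₁ e)) = inj₁ e
  swap₁₂ (inj₂ (inj₂ e)) = inj₂ (inj₂ e)

  swap₂₃ : OneOf3 u a b c → OneOf3 u a c b
  swap₂₃ (inj₁ e) = inj₁ e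
  swap₂₃ (inj₂ (inj₁ e)) = inj₂ (inj₂ e)
  swap₂₃ (inj₂ (inj₂ e)) = inj₂ (inj₁ e)

  dropFirst : OneOf3 u a b c → u ≢ a → u ≡ b ⊎ u ≡ c
  dropFirst (inj₁ u≡a) u≢a = ⊥-elim (u≢a u≡a)
  dropFirst (inj₂ rest) _ = rest

completeTriple : ∀ {n} {a b c w₁ w₂ : Fin n} → OneOf3 w₁ a b c → OneOf3 w₂ a b c → w₁ ≢ w₂ →
  Σ (Fin n) λ w₃ → ∀ {u} → OneOf3 u a b c → OneOf3 u w₁ w₂ w₃
completeTriple {c = c} (inj₁ refl) (inj₂ (inj₁ refl)) _ = c , λ h → h
completeTriple {b = b} (inj₁ refl) (inj₂ (inj₂ refl)) _ = b , swap₂₃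
completeTriple {c = c} (inj₂ (inj₁ refl)) (inj₁ refl) _ = c , swap₁₂
completeTriple {a = a} (inj₂ (inj₁ refl)) (inj₂ (inj₂ refl)) _ = a , λ h → swap₂₃ (swap₁₂ h)
completeTriple {b = b} (inj₂ (inj₂ refl)) (inj₁ refl) _ = b , λ h → swap₁₂ (swap₂₃ h)
completeTriple {a = a} (inj₂ (inj₂ refl)) (inj₂ (inj₁ refl)) _ = a , λ h → swap₁₂ (swap₂₃ (swap₁₂ h))
completeTriple (inj₁ refl) (inj₁ refl) w₁≢w₂ = ⊥-elim (w₁≢w₂ refl)
completeTriple (inj₂ (inj₁ refl)) (inj₂ (inj₁ refl)) w₁≢w₂ = ⊥-elim (w₁≢w₂ refl)
completeTriple (inj₂ (inj₂ refl)) (inj₂ (inj₂ refl)) w₁≢w₂ = ⊥-elim (w₁≢w₂ refl)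

secondNbr-≢ : ∀ {n} {G : Graph n} {u v} → SecondNbr G u v → u ≢ v
secondNbr-≢ {G = G} {u} (_ , far) u≡v = far 0 z≤n (subst (λ x → Walk G u x 0) u≡v here)

module _ {n} (G : Graph n) (cubic : Cubic G) where

  thirdNeighbour : ∀ {v w₁ w₂} → Adj G v w₁ → Adj G v w₂ → w₁ ≢ w₂ →
    Σ (Fin n) λ w₃ → ∀ u → Adj G v u → OneOf3 u w₁ w₂ w₃
  thirdNeighbour {v} a₁ a₂ w₁≢w₂ with cubic v
  ... | a , b , c , _ , _ , _ , nbrs with completeTriple (proj₁ (nbrs _) a₁) (proj₁ (nbrs _) a₂) w₁≢w₂
  ... | w₃ , reorder = w₃ , λ u adj → reorder (proj₁ (nbrs u) adj)

  otherNeighbours : ∀ {m v} → Adj G m v → Σ (Fin n) λ o₁ → Σ (Fin n) λ o₂ →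
    ∀ u → Adj G m u → u ≢ v → u ≡ o₁ ⊎ u ≡ o₂
  otherNeighbours {m} {v} adj with cubic m
  ... | a , b , c , _ , _ , _ , nbrs with proj₁ (nbrs v) adj
  ... | inj₁ refl = b , c , λ u adj′ → dropFirst (proj₁ (nbrs u) adj′)
  ... | inj₂ (inj₁ refl) = a , c , λ u adj′ → dropFirst (swap₁₂ (proj₁ (nbrs u) adj′))
  ... | inj₂ (inj₂ refl) = a , b , λ u adj′ → dropFirst (swap₁₂ (swap₂₃ (proj₁ (nbrs u) adj′)))

  secondNeighbours : ∀ v → Σ (List (Fin n)) λ us → length us ≡ 6 × (∀ u → SecondNbr G u v → u ∈ˡ us)
  secondNeighbours v with cubic v
  ... | a , b , c , _ , _ , _ , nbrs = pair Oa ++ pair Ob ++ pair Oc , refl , covered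
    where
    Others : Fin n → Set
    Others m = Σ (Fin n) λ o₁ → Σ (Fin n) λ o₂ → ∀ u → Adj G m u → u ≢ v → u ≡ o₁ ⊎ u ≡ o₂
    pair : ∀ {m} → Others m → List (Fin n)
    pair (o₁ , o₂ , _) = o₁ ∷ o₂ ∷ []
    others : ∀ m → OneOf3 m a b c → Others m
    others m m∈ = otherNeighbours (Graph.sym G (proj₂ (nbrs m) m∈))
    Oa = others a (inj₁ refl)
    Ob = others b (inj₂ (inj₁ refl))
    Oc = others c (inj₂ (inj₂ refl))
    inPair : ∀ {m u} (O : Others m) → Adj G m u → u ≢ v → u ∈ˡ pair O
    inPair (o₁ , o₂ , cover) adj u≢v with cover _ adj u≢v
    ... | inj₁ refl = here refl
    ... | inj₂ refl = there (here refl)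
    covered : ∀ u → SecondNbr G u v → u ∈ˡ pair Oa ++ pair Ob ++ pair Oc
    covered u second@(step {w = m} u-m (step m-v here) , _) with proj₁ (nbrs m) (Graph.sym G m-v)
    ... | inj₁ refl = ∈-++⁺ˡ (inPair Oa (Graph.sym G u-m) (secondNbr-≢ second))
    ... | inj₂ (inj₁ refl) = ∈-++⁺ʳ (pair Oa) (∈-++⁺ˡ (inPair Ob (Graph.sym G u-m) (secondNbr-≢ second)))
    ... | inj₂ (inj₂ refl) = ∈-++⁺ʳ (pair Oa) (∈-++⁺ʳ (pair Ob) (inPair Oc (Graph.sym G u-m) (secondNbr-≢ second)))

  secondNeighboursBesides : ∀ {x v} → SecondNbr G x v →
    Σ (List (Fin n)) λ rest → length rest ≡ 5 × (∀ u → SecondNbr G u v → u ≢ x → u ∈ˡ rest)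
  secondNeighboursBesides {x} {v} x-second with secondNeighbours v
  ... | us , ∣us∣≡6 , covered = (us ─ x∈us) , ∣rest∣≡5 , λ u u-second u≢x → All.lookup inRest (covered u u-second) u≢x
    where
    x∈us = covered x x-second
    ∣rest∣≡5 : length (us ─ x∈us) ≡ 5
    ∣rest∣≡5 = suc-injective (trans (sym (length-removeAt′ us _)) ∣us∣≡6)
    inRest : All.All (λ u → u ≢ x → u ∈ˡ (us ─ x∈us)) us
    inRest = ─⁻ x∈us (λ lookup≢x → ⊥-elim (lookup≢x (sym (lookup-result x∈us))))
                     (All.tabulate (λ u∈rest _ → u∈rest))

label : Maybe (Subset 8) → Subset 8
label = fromMaybe ∅

nothing≢just : ∀ {s : Subset 8} → nothing ≢ just s
nothing≢just ()

T-not-both : ∀ {b} → T b → T (not b) → ⊥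
T-not-both {true} _ ()

label-just : ∀ {m} → Is-just m → m ≡ just (label m)
label-just (MaybeAny.just _) = refl

ThreeDifferent : ∀ {n} → (PColoring n → PColoring n → PColoring n → Set) → Set
ThreeDifferent {n} Q = Σ (PColoring n) λ g → Σ (PColoring n) λ h → Σ (PColoring n) λ k →
  Differ g h × Differ g k × Differ h k × Q g h k

ThreeDifferent-map : ∀ {n} {Q R : PColoring n → PColoring n → PColoring n → Set} →
  (∀ {g h k} → Q g h k → R g h k) → ThreeDifferent Q → ThreeDifferent R
ThreeDifferent-map q⇒r (g , h , k , g≢h , g≢k , h≢k , q) = g , h , k , g≢h , g≢k , h≢k , q⇒r q

ThreeExtensions : ∀ {n} → Graph n → PColoring n → Fin n → Set
ThreeExtensions G f′ v = ThreeDifferent λ g h k → Extension G f′ g v × Extension G f′ h v × Extension G f′ k v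

module Situation {n} (G : Graph n) (cubic : Cubic G) (v w₁ w₂ : Fin n)
  (v-w₁ : Adj G v w₁) (v-w₂ : Adj G v w₂) (w₁≢w₂ : w₁ ≢ w₂)
  (f : PColoring n) (f-tone : Is2Tone8 G f) (fv≡nothing : f v ≡ nothing) (fw₂≡nothing : f w₂ ≡ nothing)
  (x : Fin n) (x-second : SecondNbr G x v) where

  w₃ : Fin n
  w₃ = proj₁ (thirdNeighbour G cubic v-w₁ v-w₂ w₁≢w₂)

  neighbours : ∀ u → Adj G v u → OneOf3 u w₁ w₂ w₃
  neighbours = proj₂ (thirdNeighbour G cubic v-w₁ v-w₂ w₁≢w₂)

  rest : List (Fin n)
  rest = proj₁ (secondNeighboursBesides G cubic x-second)

  C : Subset 8
  C = label (f w₃)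

  Y : List (Subset 8)
  Y = map (λ u → label (f u)) rest

  ∣C∣≤2 : ∣ C ∣ ≤ 2
  ∣C∣≤2 with f w₃ in e
  ... | nothing = ≤-trans (≤-reflexive (∣⊥∣≡0 8)) z≤n
  ... | just s = ≤-reflexive (proj₁ f-tone w₃ s e)

  ∣Y∣≤5 : length Y ≤ 5
  ∣Y∣≤5 = ≤-reflexive (trans (length-map _ rest) (proj₁ (proj₂ (secondNeighboursBesides G cubic x-second))))

  inRest : ∀ u → SecondNbr G u v → u ≢ x → u ∈ˡ rest
  inRest = proj₂ (proj₂ (secondNeighboursBesides G cubic x-second))

  module PerExtension (f′ : PColoring n) (ext : Extension G f f′ w₁) (unobstructed : ¬ YieldsObstruction G f′ x v) where

    f′-tone : Is2Tone8 G f′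
    f′-tone = proj₁ ext

    agrees : ∀ u → u ≢ w₁ → f′ u ≡ f u
    agrees = proj₂ (proj₂ (proj₂ ext))

    L : Subset 8
    L = label (f′ w₁)

    f′w₁≡L : f′ w₁ ≡ just L
    f′w₁≡L = label-just (proj₁ (proj₂ (proj₂ ext)))

    ∣L∣≡2 : ∣ L ∣ ≡ 2
    ∣L∣≡2 = proj₁ f′-tone w₁ L f′w₁≡L

    candidate : ∀ {P} → Disjoint P (L ∪ C) → ∣ P ∣ ≡ 2 → Candidate G f′ v P
    candidate {P} disj ∣P∣≡2 = ∣P∣≡2 , λ c c∈P u t v-u e → blocked c∈P u t v-u e
      where
      blocked : ∀ {c} → c ∈ P → ∀ u t → Adj G v u → f′ u ≡ just t → c ∉ t
      blocked c∈P u t v-u e with u ≟ w₁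
      ... | yes refl = λ c∈t → disj c∈P (p⊆p∪q C (subst (_ ∈_) (just-injective (trans (sym e) f′w₁≡L)) c∈t))
      ... | no u≢w₁ with neighbours u v-u
      ...   | inj₁ u≡w₁ = ⊥-elim (u≢w₁ u≡w₁)
      ...   | inj₂ (inj₁ refl) = ⊥-elim (nothing≢just (trans (sym fw₂≡nothing) (trans (sym (agrees u u≢w₁)) e)))
      ...   | inj₂ (inj₂ refl) =
        λ c∈t → disj c∈P (q⊆p∪q L C (subst (_ ∈_) (sym (cong label (trans (sym (agrees u u≢w₁)) e))) c∈t))

    f′v≡nothing : f′ v ≡ nothing
    f′v≡nothing = trans (agrees v (λ v≡w₁ → irrefl G (subst (Adj G v) (sym v≡w₁) v-w₁))) fv≡nothing

    -- A candidate label not listed in Y is no obstruction: the second-neighbour x does not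
    -- carry it by assumption, and all others carry labels in Y.
    unforbidden : ∀ {P} → Candidate G f′ v P → T (not (listed Y P)) → ∀ u → SecondNbr G u v → f′ u ≢ just P
    unforbidden {P} cand unlisted u u-second f′u≡P with u ≟ x
    ... | yes refl = unobstructed (x-second , P , f′u≡P , cand)
    ... | no u≢x = T-not-both (listed-complete (subst (_∈ˡ Y) labelP (∈-map⁺ _ (inRest u u-second u≢x)))) unlisted
      where
      u≢w₁ : u ≢ w₁
      u≢w₁ refl = proj₂ u-second 1 ≤-refl (step (Graph.sym G v-w₁) here)
      labelP : label (f u) ≡ P
      labelP = cong label (trans (sym (agrees u u≢w₁)) f′u≡P)

    valid-extends : ∀ P → T (valid (L ∪ C) Y P) → Extension G f′ (f′ [ v ↦ P ]) v
    valid-extends P valid-P with Equivalence.to Bool.T-∧ valid-P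
    ... | free , unlisted with freePair-elim {A = L ∪ C} {P} free
    ...   | disj , ∣P∣≡2 =
      candidate-extends G f′ v P f′-tone (candidate disj ∣P∣≡2) (unforbidden (candidate disj ∣P∣≡2) unlisted) f′v≡nothing

    threeExtensions : 3 ≤ count (valid (L ∪ C) Y) → ThreeExtensions G f′ v
    threeExtensions three = extensions (three-witnesses (valid (L ∪ C) Y) three)
      where
      extensions : ThreeDistinct (valid (L ∪ C) Y) → ThreeExtensions G f′ v
      extensions (P₁ , P₂ , P₃ , P₁≢P₂ , P₁≢P₃ , P₂≢P₃ , valid₁ , valid₂ , valid₃) =
        f′ [ v ↦ P₁ ] , f′ [ v ↦ P₂ ] , f′ [ v ↦ P₃ ] ,
        update-differ f′ v P₁≢P₂ , update-differ f′ v P₁≢P₃ , update-differ f′ v P₂≢P₃ ,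
        valid-extends P₁ valid₁ , valid-extends P₂ valid₂ , valid-extends P₃ valid₃

  labels-differ : ∀ {f₁ f₂} → Extension G f f₁ w₁ → Extension G f f₂ w₁ → Differ f₁ f₂ →
    label (f₁ w₁) ≢ label (f₂ w₁)
  labels-differ {f₁} {f₂} e₁ e₂ f₁≠f₂ same-label = f₁≠f₂ agree
    where
    agree : ∀ u → f₁ u ≡ f₂ u
    agree u with u ≟ w₁
    ... | yes refl = trans (label-just (proj₁ (proj₂ (proj₂ e₁))))
                           (trans (cong just same-label) (sym (label-just (proj₁ (proj₂ (proj₂ e₂))))))
    ... | no u≢w₁ = trans (proj₂ (proj₂ (proj₂ e₁)) u u≢w₁) (sym (proj₂ (proj₂ (proj₂ e₂)) u u≢w₁))

mainTheorem8 : ∀ {n} (G : Graph n) → Cubic G →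
    (v w₁ w₂ : Fin n) → Adj G v w₁ → Adj G v w₂ → w₁ ≢ w₂ →
    (f : PColoring n) → Is2Tone8 G f →
    f v ≡ nothing → f w₁ ≡ nothing → f w₂ ≡ nothing →
    (f₁ f₂ f₃ : PColoring n) →
    Extension G f f₁ w₁ → Extension G f f₂ w₁ → Extension G f f₃ w₁ →
    Differ f₁ f₂ → Differ f₁ f₃ → Differ f₂ f₃ →
    (Σ (Fin n) λ x → SecondNbr G x v ×
       ¬ YieldsObstruction G f₁ x v × ¬ YieldsObstruction G f₂ x v × ¬ YieldsObstruction G f₃ x v) →
    Σ (PColoring n) λ g → Σ (PColoring n) λ h → Σ (PColoring n) λ k →
      Differ g h × Differ g k × Differ h k ×
      ((Extension G f₁ g v × Extension G f₁ h v × Extension G f₁ k v) ⊎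
       ((Extension G f₂ g v × Extension G f₂ h v × Extension G f₂ k v) ⊎
        (Extension G f₃ g v × Extension G f₃ h v × Extension G f₃ k v)))
mainTheorem8 G cubic v w₁ w₂ v-w₁ v-w₂ w₁≢w₂ f f-tone fv≡nothing _ fw₂≡nothing f₁ f₂ f₃ e₁ e₂ e₃
  f₁≠f₂ f₁≠f₃ f₂≠f₃ (x , x-second , unobstructed₁ , unobstructed₂ , unobstructed₃) =
  [ ThreeDifferent-map inj₁ ∘ E₁.threeExtensions
  , [ ThreeDifferent-map (inj₂ ∘ inj₁) ∘ E₂.threeExtensions
    , ThreeDifferent-map (inj₂ ∘ inj₂) ∘ E₃.threeExtensions ] ] someLabelHasThree
  where
  open Situation G cubic v w₁ w₂ v-w₁ v-w₂ w₁≢w₂ f f-tone fv≡nothing fw₂≡nothing x x-second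
  module E₁ = PerExtension f₁ e₁ unobstructed₁
  module E₂ = PerExtension f₂ e₂ unobstructed₂
  module E₃ = PerExtension f₃ e₃ unobstructed₃
  open ThreeLabels E₁.L E₂.L E₃.L C Y E₁.∣L∣≡2 E₂.∣L∣≡2 E₃.∣L∣≡2
    (labels-differ e₁ e₂ f₁≠f₂) (labels-differ e₁ e₃ f₁≠f₃) (labels-differ e₂ e₃ f₂≠f₃) ∣C∣≤2 ∣Y∣≤5
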